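{- Let $\mathbb K$ be a field of characteristic zero, $\mathfrak d$ a delta operator on $\mathbb K[x]$ with basic sequence $(p_n(x))_{n\ge0}$, and $\mathcal Z=(z_i)_{i\ge0}$ a sequence in $\mathbb K$. For each $j\in\mathbb N$ let $(t_n^{(j)}(x))_{n\ge0}$ be the generalized Gončarov basis associated with $(\mathfrak d,\mathcal Z^{(j)})$, and let $t_n:=t_n^{(0)}$. Then for all $\xi\in\mathbb K$ and $n\in\mathbb N$, $$t_n(x+\xi)=\sum_{i=0}^n\binom ni t^{(i)}_{n-i}(\xi)\,p_i(x),$$ and in particular $t_n(x)=\sum_{i=0}^n\binom ni t^{(i)}_{n-i}(0)\,p_i(x)$.
   Context: A shift-invariant operator on $\mathbb K[x]$ is a linear operator commuting with all shifts $f(x)\mapsto f(x+a)$; a delta operator is a shift-invariant operator $\mathfrak d$ with $\mathfrak d(x)$ a nonzero constant. The basic sequence of $\mathfrak d$ is the unique polynomial sequence $(p_n)_{n\ge0}$ with $p_0=1$, $p_n(0)=0$ for $n\ge1$, and $\mathfrak d(p_n)=np_{n-1}$. The shifted grid $\mathcal Z^{(j)}$ has $i$-th term $z_{i+j}$. For a sequence $\mathcal W=(w_i)_{i\ge 0}$ in $\mathbb K$, the generalized Gončarov basis associated with $(\mathfrak d,\mathcal W)$ is the unique sequence of polynomials $(t_n)_{n\ge0}$ with $\deg t_n=n$ and $\varepsilon_{w_i}(\mathfrak d^i t_n)=n!\,\delta_{i,n}$ for all $i,n$ ($\varepsilon_w$ evaluation at $w$, $\mathfrak d^i$ the $i$-th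 iterate). -}

module Defs where

open import Level using (_⊔_)
open import Algebra.Bundles using (CommutativeRing)
open import Data.Nat using (ℕ; zero; suc; _<_; _∸_; _!)
open import Data.Nat.Combinatorics using (_C_)
open import Data.List using (List; []; _∷_; map)
open import Data.Product using (Σ; _×_; ∃)
open import Relation.Nullary using (¬_)
open import Relation.Binary.PropositionalEquality using (_≡_; _≢_)

module _ {c ℓ} (R : CommutativeRing c ℓ) where
  open CommutativeRing R

  IsField : Set (c ⊔ ℓ)
  IsField = (¬ (1# ≈ 0#)) × (∀ a → ¬ (a ≈ 0#) → ∃ λ b → a * b ≈ 1#)

  fromℕ : ℕ → Carrier
  fromℕ zero    = 0#
  fromℕ (suc n) = 1# + fromℕ n

  CharZero : Set ℓ
  CharZero = ∀ n → ¬ (fromℕ (suc n) ≈ 0#)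

  -- polynomials in K[x]: coefficient lists, constant term first
  Poly : Set c
  Poly = List Carrier

  coeff : Poly → ℕ → Carrier
  coeff []      _       = 0#
  coeff (a ∷ f) zero    = a
  coeff (a ∷ f) (suc k) = coeff f k

  -- equality of polynomials: equal coefficients (trailing zeros irrelevant)
  _≈P_ : Poly → Poly → Set ℓ
  f ≈P g = ∀ k → coeff f k ≈ coeff g k

  constP : Carrier → Poly
  constP a = a ∷ []

  0P : Poly
  0P = []

  X : Poly
  X = 0# ∷ 1# ∷ []

  _+P_ : Poly → Poly → Poly
  []      +P g       = g
  (a ∷ f) +P []      = a ∷ f
  (a ∷ f) +P (b ∷ g) = (a + b) ∷ (f +P g)

  _·P_ : Carrier → Poly → Poly
  a ·P f = map (a *_) f

  eval : Poly → Carrier → Carrier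
  eval []      w = 0#
  eval (a ∷ f) w = a + w * eval f w

  -- f(x) ↦ f(x + a)   (Horner: a₀ + (x + a)·f₁(x + a))
  shift : Carrier → Poly → Poly
  shift a []      = []
  shift a (b ∷ f) = constP b +P ((0# ∷ g) +P (a ·P g))
    where g = shift a f

  HasDegree : Poly → ℕ → Set ℓ
  HasDegree f n = (¬ (coeff f n ≈ 0#)) × (∀ k → n < k → coeff f k ≈ 0#)

  record LinOp : Set (c ⊔ ℓ) where
    field
      op      : Poly → Poly
      op-cong : ∀ f g → f ≈P g → op f ≈P op g
      op-+    : ∀ f g → op (f +P g) ≈P (op f +P op g)
      op-·    : ∀ a f → op (a ·P f) ≈P (a ·P op f)
  open LinOp public

  ShiftInvariant : LinOp → Set (c ⊔ ℓ)
  ShiftInvariant T = ∀ a f → op T (shift a f) ≈P shift a (op T f)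

  IsDelta : LinOp → Set (c ⊔ ℓ)
  IsDelta T = ShiftInvariant T × (∃ λ b → (¬ (b ≈ 0#)) × (op T X ≈P constP b))

  iter : LinOp → ℕ → Poly → Poly
  iter T zero    f = f
  iter T (suc i) f = op T (iter T i f)

  IsBasicSequence : LinOp → (ℕ → Poly) → Set ℓ
  IsBasicSequence T p =
    (∀ n → HasDegree (p n) n) ×
    (p 0 ≈P constP 1#) ×
    (∀ n → eval (p (suc n)) 0# ≈ 0#) ×
    (∀ n → op T (p (suc n)) ≈P (fromℕ (suc n) ·P p n))

  IsGoncarovBasis : LinOp → (ℕ → Carrier) → (ℕ → Poly) → Set ℓ
  IsGoncarovBasis T w t =
    (∀ n → HasDegree (t n) n) ×
    (∀ n → eval (iter T n (t n)) (w n) ≈ fromℕ (n !)) ×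
    (∀ i n → i ≢ n → eval (iter T i (t n)) (w i) ≈ 0#)

  sumP : ℕ → (ℕ → Poly) → Poly
  sumP zero    g = g 0
  sumP (suc n) g = sumP n g +P g (suc n)

-- For a Gončarov basis (sₙ) of (𝔡, w), the functionals ε_{wᵢ} ∘ 𝔡ⁱ (i ≤ n) determine a polynomial
-- of degree ≤ n: expanding it in s₀ … sₙ, the i-th functional returns i! times the i-th
-- coefficient, and i! ≠ 0 in characteristic zero. The basic sequence (pₙ) is the Gončarov basis of
-- the constant grid 0, since 𝔡ⁱ pₖ = k(k−1)⋯(k−i+1) p_{k−i} and 𝔡 kills constants. Comparing
-- functionals gives first 𝔡ᵏ tₙ = C(n,k) k! t^{(k)}_{n−k}, and then
-- tₙ(x + ξ) = Σ C(n,i) t^{(i)}_{n−i}(ξ) pᵢ(x), because shift invariance turns ε₀ ∘ 𝔡ⁱ ∘ (x ↦ x + ξ)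
-- into ε_ξ ∘ 𝔡ⁱ.
module Submission where

open import Algebra.Bundles using (CommutativeRing)
open import Data.Nat using (ℕ)
open import Defs
import Relation.Binary.Reasoning.Setoid as SetoidReasoning

module Binomial where

  open import Data.Nat using (_*_; _∸_; _≤_; _!)
  open import Data.Nat.Properties using (*-assoc; _!*_!≢0)
  open import Data.Nat.Combinatorics using (_C_; nCk≡n!/k![n-k]!; k![n∸k]!∣n!)
  open import Data.Nat.DivMod using (m/n*n≡m)
  open import Relation.Binary.PropositionalEquality using (_≡_; cong; trans)

  nCk*k!*[n∸k]!≡n! : ∀ {n k} → k ≤ n → (n C k) * k ! * (n ∸ k) ! ≡ n !
  nCk*k!*[n∸k]!≡n! {n} {k} k≤n =
    trans (*-assoc (n C k) (k !) ((n ∸ k) !))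
      (trans (cong (_* (k ! * (n ∸ k) !)) (nCk≡n!/k![n-k]! k≤n))
             (m/n*n≡m {{k !* (n ∸ k) !≢0}} (k![n∸k]!∣n! k≤n)))

module Polynomials {c ℓ} (R : CommutativeRing c ℓ) where

  open CommutativeRing R
  open import Data.Nat using (ℕ; zero; suc; _≤_; z≤n; s≤s)
  open import Data.Nat.Properties using (≤-refl; ≤-trans; n≤1+n; m≤n⇒m≤1+n; 1+n≰n; ≤∧≢⇒<; ≤-pred; _≟_)
  open import Data.List using ([]; _∷_)
  open import Data.Product using (_,_)
  open import Relation.Nullary using (yes; no)
  open import Relation.Binary.Bundles using (Setoid)
  open import Relation.Binary.PropositionalEquality as ≡ using (_≢_)
  open import Algebra.Properties.Ring ring using (-1*x≈-x)
  open import Algebra.Properties.AbelianGroup +-abelianGroup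
    using (x∙y⁻¹≈ε⇒x≈y; //-rightDividesˡ; identityˡ-unique)
  open import Algebra.Properties.CommutativeSemigroup +-commutativeSemigroup
    using () renaming (interchange to +-interchange)
  open import Algebra.Properties.CommutativeSemigroup *-commutativeSemigroup
    using () renaming (x∙yz≈y∙xz to x*yz≈y*xz)

  module ≈-Reasoning = SetoidReasoning setoid

  infix  4 _≈ₚ_
  infixl 6 _+ₚ_ _-ₚ_
  infixr 7 _·ₚ_

  -- Records rather than the bare Π-types, so that Agda can infer the polynomial from the type.
  record _≈ₚ_ (f g : Poly R) : Set ℓ where
    constructor coeffwise
    field coeff-≈ : _≈P_ R f g
  open _≈ₚ_ public

  record DegreeBelow (f : Poly R) (m : ℕ) : Set ℓ where
    constructor degreeBelow
    field coeff-≈0 : ∀ k → m ≤ k → coeff R f k ≈ 0#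
  open DegreeBelow public

  _+ₚ_ : Poly R → Poly R → Poly R
  _+ₚ_ = _+P_ R

  _·ₚ_ : Carrier → Poly R → Poly R
  _·ₚ_ = _·P_ R

  _-ₚ_ : Poly R → Poly R → Poly R
  f -ₚ g = f +ₚ (- 1#) ·ₚ g

  0ₚ : Poly R
  0ₚ = 0P R

  ≈ₚ-setoid : Setoid c ℓ
  ≈ₚ-setoid = record
    { Carrier       = Poly R
    ; _≈_           = _≈ₚ_
    ; isEquivalence = record
      { refl  = coeffwise λ _ → refl
      ; sym   = λ f≈g → coeffwise λ k → sym (coeff-≈ f≈g k)
      ; trans = λ f≈g g≈h → coeffwise λ k → trans (coeff-≈ f≈g k) (coeff-≈ g≈h k)
      }
    }

  open Setoid ≈ₚ-setoid public
    using () renaming (refl to ≈ₚ-refl; sym to ≈ₚ-sym; trans to ≈ₚ-trans)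

  module ≈ₚ-Reasoning = SetoidReasoning ≈ₚ-setoid

  coeff-+ₚ : ∀ f g k → coeff R (f +ₚ g) k ≈ coeff R f k + coeff R g k
  coeff-+ₚ []      g       k       = sym (+-identityˡ _)
  coeff-+ₚ (a ∷ f) []      k       = sym (+-identityʳ _)
  coeff-+ₚ (a ∷ f) (b ∷ g) zero    = refl
  coeff-+ₚ (a ∷ f) (b ∷ g) (suc k) = coeff-+ₚ f g k

  coeff-·ₚ : ∀ a f k → coeff R (a ·ₚ f) k ≈ a * coeff R f k
  coeff-·ₚ a []      k       = sym (zeroʳ a)
  coeff-·ₚ a (b ∷ f) zero    = refl
  coeff-·ₚ a (b ∷ f) (suc k) = coeff-·ₚ a f k

  coeff-‿ₚ : ∀ f g k → coeff R (f -ₚ g) k ≈ coeff R f k + - coeff R g k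
  coeff-‿ₚ f g k = trans (coeff-+ₚ f _ k) (+-congˡ (trans (coeff-·ₚ (- 1#) g k) (-1*x≈-x _)))

  +ₚ-cong : ∀ {f f′ g g′} → f ≈ₚ f′ → g ≈ₚ g′ → f +ₚ g ≈ₚ f′ +ₚ g′
  +ₚ-cong {f} {f′} {g} {g′} f≈f′ g≈g′ = coeffwise λ k → begin
    coeff R (f +ₚ g) k            ≈⟨ coeff-+ₚ f g k ⟩
    coeff R f k + coeff R g k     ≈⟨ +-cong (coeff-≈ f≈f′ k) (coeff-≈ g≈g′ k) ⟩
    coeff R f′ k + coeff R g′ k   ≈⟨ coeff-+ₚ f′ g′ k ⟨
    coeff R (f′ +ₚ g′) k          ∎
    where open ≈-Reasoning

  +ₚ-identityʳ : ∀ f → f +ₚ 0ₚ ≈ₚ f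
  +ₚ-identityʳ f = coeffwise λ k → trans (coeff-+ₚ f 0ₚ k) (+-identityʳ _)

  ·ₚ-cong : ∀ {a b f g} → a ≈ b → f ≈ₚ g → a ·ₚ f ≈ₚ b ·ₚ g
  ·ₚ-cong {a} {b} {f} {g} a≈b f≈g = coeffwise λ k → begin
    coeff R (a ·ₚ f) k   ≈⟨ coeff-·ₚ a f k ⟩
    a * coeff R f k      ≈⟨ *-cong a≈b (coeff-≈ f≈g k) ⟩
    b * coeff R g k      ≈⟨ coeff-·ₚ b g k ⟨
    coeff R (b ·ₚ g) k   ∎
    where open ≈-Reasoning

  ·ₚ-congˡ : ∀ a {f g} → f ≈ₚ g → a ·ₚ f ≈ₚ a ·ₚ g
  ·ₚ-congˡ a = ·ₚ-cong refl

  ·ₚ-zeroˡ : ∀ {a} f → a ≈ 0# → a ·ₚ f ≈ₚ 0ₚ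
  ·ₚ-zeroˡ {a} f a≈0 = coeffwise λ k → trans (coeff-·ₚ a f k) (trans (*-congʳ a≈0) (zeroˡ _))

  ·ₚ-zeroʳ : ∀ a {f} → f ≈ₚ 0ₚ → a ·ₚ f ≈ₚ 0ₚ
  ·ₚ-zeroʳ a {f} f≈0 = coeffwise λ k → trans (coeff-·ₚ a f k) (trans (*-congˡ (coeff-≈ f≈0 k)) (zeroʳ a))

  ·ₚ-identityˡ : ∀ f → 1# ·ₚ f ≈ₚ f
  ·ₚ-identityˡ f = coeffwise λ k → trans (coeff-·ₚ 1# f k) (*-identityˡ _)

  ·ₚ-assoc : ∀ a b f → (a * b) ·ₚ f ≈ₚ a ·ₚ (b ·ₚ f)
  ·ₚ-assoc a b f = coeffwise λ k → begin
    coeff R ((a * b) ·ₚ f) k   ≈⟨ coeff-·ₚ (a * b) f k ⟩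
    (a * b) * coeff R f k      ≈⟨ *-assoc a b _ ⟩
    a * (b * coeff R f k)      ≈⟨ *-congˡ (coeff-·ₚ b f k) ⟨
    a * coeff R (b ·ₚ f) k     ≈⟨ coeff-·ₚ a (b ·ₚ f) k ⟨
    coeff R (a ·ₚ (b ·ₚ f)) k  ∎
    where open ≈-Reasoning

  -ₚ≈0⇒≈ₚ : ∀ {f g} → f -ₚ g ≈ₚ 0ₚ → f ≈ₚ g
  -ₚ≈0⇒≈ₚ {f} {g} f-g≈0 = coeffwise λ k →
    x∙y⁻¹≈ε⇒x≈y _ _ (trans (sym (coeff-‿ₚ f g k)) (coeff-≈ f-g≈0 k))

  -ₚ+ₚ-cancel : ∀ f g → (f -ₚ g) +ₚ g ≈ₚ f
  -ₚ+ₚ-cancel f g = coeffwise λ k →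
    trans (coeff-+ₚ (f -ₚ g) g k) (trans (+-congʳ (coeff-‿ₚ f g k)) (//-rightDividesˡ _ _))

  +ₚ-identityˡ-unique : ∀ {f g} → f +ₚ g ≈ₚ g → f ≈ₚ 0ₚ
  +ₚ-identityˡ-unique {f} {g} f+g≈g = coeffwise λ k →
    identityˡ-unique _ _ (trans (sym (coeff-+ₚ f g k)) (coeff-≈ f+g≈g k))

  ∷-cong : ∀ {a b f g} → a ≈ b → f ≈ₚ g → (a ∷ f) ≈ₚ (b ∷ g)
  ∷-cong a≈b f≈g = coeffwise λ { zero → a≈b ; (suc k) → coeff-≈ f≈g k }

  ∷-≈0 : ∀ {a f} → a ≈ 0# → f ≈ₚ 0ₚ → (a ∷ f) ≈ₚ 0ₚ
  ∷-≈0 a≈0 f≈0 = coeffwise λ { zero → a≈0 ; (suc k) → coeff-≈ f≈0 k }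

  sum≤ : ℕ → (ℕ → Carrier) → Carrier
  sum≤ zero    g = g 0
  sum≤ (suc n) g = sum≤ n g + g (suc n)

  sum≤-cong : ∀ n {g h} → (∀ i → i ≤ n → g i ≈ h i) → sum≤ n g ≈ sum≤ n h
  sum≤-cong zero    g≈h = g≈h 0 z≤n
  sum≤-cong (suc n) g≈h = +-cong (sum≤-cong n λ i i≤n → g≈h i (m≤n⇒m≤1+n i≤n)) (g≈h (suc n) ≤-refl)

  sum≤-zero : ∀ n {g} → (∀ i → i ≤ n → g i ≈ 0#) → sum≤ n g ≈ 0#
  sum≤-zero zero    g≈0 = g≈0 0 z≤n
  sum≤-zero (suc n) g≈0 =
    trans (+-cong (sum≤-zero n λ i i≤n → g≈0 i (m≤n⇒m≤1+n i≤n)) (g≈0 (suc n) ≤-refl)) (+-identityʳ 0#)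

  sum≤-single : ∀ n {g k} → k ≤ n → (∀ i → i ≤ n → i ≢ k → g i ≈ 0#) → sum≤ n g ≈ g k
  sum≤-single zero    z≤n _ = refl
  sum≤-single (suc n) {g} {k} k≤1+n others with k ≟ suc n
  ... | yes ≡.refl = trans (+-congʳ (sum≤-zero n λ i i≤n → others i (m≤n⇒m≤1+n i≤n) λ { ≡.refl → 1+n≰n i≤n }))
                           (+-identityˡ _)
  ... | no k≢1+n   = trans (+-cong (sum≤-single n (≤-pred (≤∧≢⇒< k≤1+n k≢1+n)) λ i i≤n → others i (m≤n⇒m≤1+n i≤n))
                                   (others (suc n) ≤-refl λ e → k≢1+n (≡.sym e)))
                           (+-identityʳ _)

  coeff-sumP : ∀ n g k → coeff R (sumP R n g) k ≈ sum≤ n (λ i → coeff R (g i) k)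
  coeff-sumP zero    g k = refl
  coeff-sumP (suc n) g k = trans (coeff-+ₚ (sumP R n g) (g (suc n)) k) (+-congʳ (coeff-sumP n g k))

  sumP-cong : ∀ n {g h} → (∀ i → i ≤ n → g i ≈ₚ h i) → sumP R n g ≈ₚ sumP R n h
  sumP-cong n {g} {h} g≈h = coeffwise λ k → begin
    coeff R (sumP R n g) k            ≈⟨ coeff-sumP n g k ⟩
    sum≤ n (λ i → coeff R (g i) k)    ≈⟨ sum≤-cong n (λ i i≤n → coeff-≈ (g≈h i i≤n) k) ⟩
    sum≤ n (λ i → coeff R (h i) k)    ≈⟨ coeff-sumP n h k ⟨
    coeff R (sumP R n h) k            ∎
    where open ≈-Reasoning

  sumP-≈0 : ∀ n {g} → (∀ i → i ≤ n → g i ≈ₚ 0ₚ) → sumP R n g ≈ₚ 0ₚ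
  sumP-≈0 n {g} g≈0 = coeffwise λ k → trans (coeff-sumP n g k) (sum≤-zero n λ i i≤n → coeff-≈ (g≈0 i i≤n) k)

  hasDegree⇒degreeBelow : ∀ {f n} → HasDegree R f n → DegreeBelow f (suc n)
  hasDegree⇒degreeBelow (_ , above) = degreeBelow above

  degreeBelow-cong : ∀ {f g m} → f ≈ₚ g → DegreeBelow f m → DegreeBelow g m
  degreeBelow-cong f≈g deg = degreeBelow λ k m≤k → trans (sym (coeff-≈ f≈g k)) (coeff-≈0 deg k m≤k)

  degreeBelow-mono : ∀ {f m m′} → m ≤ m′ → DegreeBelow f m → DegreeBelow f m′
  degreeBelow-mono m≤m′ deg = degreeBelow λ k m′≤k → coeff-≈0 deg k (≤-trans m≤m′ m′≤k)

  degreeBelow-≈0 : ∀ {f m} → f ≈ₚ 0ₚ → DegreeBelow f m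
  degreeBelow-≈0 f≈0 = degreeBelow λ k _ → coeff-≈ f≈0 k

  degreeBelow-∷ : ∀ {a f m} → DegreeBelow f m → DegreeBelow (a ∷ f) (suc m)
  degreeBelow-∷ deg = degreeBelow λ { (suc k) (s≤s m≤k) → coeff-≈0 deg k m≤k }

  degreeBelow-zero : ∀ {f} → DegreeBelow f 0 → f ≈ₚ 0ₚ
  degreeBelow-zero deg = coeffwise λ k → coeff-≈0 deg k z≤n

  degreeBelow-+ₚ : ∀ {f g m} → DegreeBelow f m → DegreeBelow g m → DegreeBelow (f +ₚ g) m
  degreeBelow-+ₚ {f} {g} degf degg = degreeBelow λ k m≤k →
    trans (coeff-+ₚ f g k) (trans (+-cong (coeff-≈0 degf k m≤k) (coeff-≈0 degg k m≤k)) (+-identityʳ 0#))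

  degreeBelow-·ₚ : ∀ {f m} a → DegreeBelow f m → DegreeBelow (a ·ₚ f) m
  degreeBelow-·ₚ {f} a deg = degreeBelow λ k m≤k →
    trans (coeff-·ₚ a f k) (trans (*-congˡ (coeff-≈0 deg k m≤k)) (zeroʳ a))

  degreeBelow-‿ₚ : ∀ {f g m} → DegreeBelow f m → DegreeBelow g m → DegreeBelow (f -ₚ g) m
  degreeBelow-‿ₚ degf degg = degreeBelow-+ₚ degf (degreeBelow-·ₚ (- 1#) degg)

  degreeBelow-sumP : ∀ n {g m} → (∀ i → i ≤ n → DegreeBelow (g i) m) → DegreeBelow (sumP R n g) m
  degreeBelow-sumP n {g} deg = degreeBelow λ k m≤k →
    trans (coeff-sumP n g k) (sum≤-zero n λ i i≤n → coeff-≈0 (deg i i≤n) k m≤k)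

  eval-≈0 : ∀ {f} w → f ≈ₚ 0ₚ → eval R f w ≈ 0#
  eval-≈0 {[]}    w f≈0 = refl
  eval-≈0 {a ∷ f} w f≈0 = begin
    a + w * eval R f w   ≈⟨ +-cong (coeff-≈ f≈0 0) (*-congˡ (eval-≈0 w (coeffwise {f} λ k → coeff-≈ f≈0 (suc k)))) ⟩
    0# + w * 0#          ≈⟨ +-identityˡ _ ⟩
    w * 0#               ≈⟨ zeroʳ w ⟩
    0#                   ∎
    where open ≈-Reasoning

  eval-cong : ∀ {f g} w → f ≈ₚ g → eval R f w ≈ eval R g w
  eval-cong {[]}    w f≈g = sym (eval-≈0 w (≈ₚ-sym f≈g))
  eval-cong {a ∷ f} {[]}    w f≈g = eval-≈0 w f≈g
  eval-cong {a ∷ f} {b ∷ g} w f≈g =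
    +-cong (coeff-≈ f≈g 0) (*-congˡ (eval-cong w (coeffwise {f} {g} λ k → coeff-≈ f≈g (suc k))))

  eval-congʳ : ∀ f {w w′} → w ≈ w′ → eval R f w ≈ eval R f w′
  eval-congʳ []      w≈w′ = refl
  eval-congʳ (a ∷ f) w≈w′ = +-congˡ (*-cong w≈w′ (eval-congʳ f w≈w′))

  eval-+ₚ : ∀ f g w → eval R (f +ₚ g) w ≈ eval R f w + eval R g w
  eval-+ₚ []      g       w = sym (+-identityˡ _)
  eval-+ₚ (a ∷ f) []      w = sym (+-identityʳ _)
  eval-+ₚ (a ∷ f) (b ∷ g) w = begin
    (a + b) + w * eval R (f +ₚ g) w                ≈⟨ +-congˡ (*-congˡ (eval-+ₚ f g w)) ⟩
    (a + b) + w * (eval R f w + eval R g w)        ≈⟨ +-congˡ (distribˡ w _ _) ⟩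
    (a + b) + (w * eval R f w + w * eval R g w)    ≈⟨ +-interchange a b _ _ ⟩
    (a + w * eval R f w) + (b + w * eval R g w)    ∎
    where open ≈-Reasoning

  eval-·ₚ : ∀ a f w → eval R (a ·ₚ f) w ≈ a * eval R f w
  eval-·ₚ a []      w = sym (zeroʳ a)
  eval-·ₚ a (b ∷ f) w = begin
    a * b + w * eval R (a ·ₚ f) w   ≈⟨ +-congˡ (*-congˡ (eval-·ₚ a f w)) ⟩
    a * b + w * (a * eval R f w)    ≈⟨ +-congˡ (x*yz≈y*xz w a _) ⟩
    a * b + a * (w * eval R f w)    ≈⟨ distribˡ a b _ ⟨
    a * (b + w * eval R f w)        ∎
    where open ≈-Reasoning

  eval-‿ₚ : ∀ f g w → eval R (f -ₚ g) w ≈ eval R f w + - eval R g w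
  eval-‿ₚ f g w = trans (eval-+ₚ f _ w) (+-congˡ (trans (eval-·ₚ (- 1#) g w) (-1*x≈-x _)))

  eval-sumP : ∀ n g w → eval R (sumP R n g) w ≈ sum≤ n (λ i → eval R (g i) w)
  eval-sumP zero    g w = refl
  eval-sumP (suc n) g w = trans (eval-+ₚ (sumP R n g) (g (suc n)) w) (+-congʳ (eval-sumP n g w))

  eval-constP : ∀ a w → eval R (constP R a) w ≈ a
  eval-constP a w = trans (+-congˡ (zeroʳ w)) (+-identityʳ a)

  shift-∷ : ∀ a b f → shift R a (b ∷ f) ≈ₚ (b ∷ shift R a f) +ₚ a ·ₚ shift R a f
  shift-∷ a b f = coeffwise λ
    { zero → begin
        coeff R (constP R b +ₚ ((0# ∷ g) +ₚ a ·ₚ g)) 0   ≈⟨ coeff-+ₚ (constP R b) ((0# ∷ g) +ₚ a ·ₚ g) 0 ⟩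
        b + coeff R ((0# ∷ g) +ₚ a ·ₚ g) 0               ≈⟨ +-congˡ (coeff-+ₚ (0# ∷ g) (a ·ₚ g) 0) ⟩
        b + (0# + coeff R (a ·ₚ g) 0)                    ≈⟨ +-congˡ (+-identityˡ _) ⟩
        b + coeff R (a ·ₚ g) 0                           ≈⟨ coeff-+ₚ (b ∷ g) (a ·ₚ g) 0 ⟨
        coeff R ((b ∷ g) +ₚ a ·ₚ g) 0                    ∎
    ; (suc k) → begin
        coeff R (constP R b +ₚ ((0# ∷ g) +ₚ a ·ₚ g)) (suc k) ≈⟨ coeff-+ₚ (constP R b) ((0# ∷ g) +ₚ a ·ₚ g) (suc k) ⟩
        0# + coeff R ((0# ∷ g) +ₚ a ·ₚ g) (suc k)           ≈⟨ +-identityˡ _ ⟩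
        coeff R ((0# ∷ g) +ₚ a ·ₚ g) (suc k)                ≈⟨ coeff-+ₚ (0# ∷ g) (a ·ₚ g) (suc k) ⟩
        coeff R g k + coeff R (a ·ₚ g) (suc k)              ≈⟨ coeff-+ₚ (b ∷ g) (a ·ₚ g) (suc k) ⟨
        coeff R ((b ∷ g) +ₚ a ·ₚ g) (suc k)                 ∎
    }
    where
    open ≈-Reasoning
    g = shift R a f

  shift-≈0 : ∀ a {f} → f ≈ₚ 0ₚ → shift R a f ≈ₚ 0ₚ
  shift-≈0 a {[]}    f≈0 = ≈ₚ-refl
  shift-≈0 a {b ∷ f} f≈0 = ≈ₚ-trans (shift-∷ a b f)
    (+ₚ-cong (∷-≈0 (coeff-≈ f≈0 0) shift-tail≈0) (·ₚ-zeroʳ a shift-tail≈0))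
    where
    shift-tail≈0 : shift R a f ≈ₚ 0ₚ
    shift-tail≈0 = shift-≈0 a (coeffwise {f} λ k → coeff-≈ f≈0 (suc k))

  shift-cong : ∀ a {f g} → f ≈ₚ g → shift R a f ≈ₚ shift R a g
  shift-cong a {[]}            f≈g = ≈ₚ-sym (shift-≈0 a (≈ₚ-sym f≈g))
  shift-cong a {b ∷ f} {[]}    f≈g = shift-≈0 a f≈g
  shift-cong a {b ∷ f} {c ∷ g} f≈g = begin
    shift R a (b ∷ f)                        ≈⟨ shift-∷ a b f ⟩
    (b ∷ shift R a f) +ₚ a ·ₚ shift R a f    ≈⟨ +ₚ-cong (∷-cong (coeff-≈ f≈g 0) shift-tail≈) (·ₚ-congˡ a shift-tail≈) ⟩
    (c ∷ shift R a g) +ₚ a ·ₚ shift R a g    ≈⟨ shift-∷ a c g ⟨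
    shift R a (c ∷ g)                        ∎
    where
    open ≈ₚ-Reasoning
    shift-tail≈ : shift R a f ≈ₚ shift R a g
    shift-tail≈ = shift-cong a (coeffwise {f} {g} λ k → coeff-≈ f≈g (suc k))

  shift-degreeBelow : ∀ a {f m} → DegreeBelow f m → DegreeBelow (shift R a f) m
  shift-degreeBelow a {[]}                deg = degreeBelow λ _ _ → refl
  shift-degreeBelow a {b ∷ f} {zero}      deg = degreeBelow-≈0 (shift-≈0 a (degreeBelow-zero deg))
  shift-degreeBelow a {b ∷ f} {suc m}     deg = degreeBelow-cong (≈ₚ-sym (shift-∷ a b f))
    (degreeBelow-+ₚ (degreeBelow-∷ shift-tail-deg) (degreeBelow-·ₚ a (degreeBelow-mono (n≤1+n m) shift-tail-deg)))
    where
    shift-tail-deg : DegreeBelow (shift R a f) m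
    shift-tail-deg = shift-degreeBelow a (degreeBelow {f} λ k m≤k → coeff-≈0 deg (suc k) (s≤s m≤k))

  shift-0# : ∀ f → shift R 0# f ≈ₚ f
  shift-0# []      = ≈ₚ-refl
  shift-0# (b ∷ f) = begin
    shift R 0# (b ∷ f)                         ≈⟨ shift-∷ 0# b f ⟩
    (b ∷ shift R 0# f) +ₚ 0# ·ₚ shift R 0# f   ≈⟨ +ₚ-cong (∷-cong refl (shift-0# f)) (·ₚ-zeroˡ (shift R 0# f) refl) ⟩
    (b ∷ f) +ₚ 0ₚ                              ≈⟨ +ₚ-identityʳ (b ∷ f) ⟩
    b ∷ f                                      ∎
    where open ≈ₚ-Reasoning

  eval-shift : ∀ a f w → eval R (shift R a f) w ≈ eval R f (w + a)
  eval-shift a []      w = refl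
  eval-shift a (b ∷ f) w = begin
    eval R (shift R a (b ∷ f)) w                 ≈⟨ eval-cong w (shift-∷ a b f) ⟩
    eval R ((b ∷ g) +ₚ a ·ₚ g) w                  ≈⟨ eval-+ₚ (b ∷ g) (a ·ₚ g) w ⟩
    (b + w * eval R g w) + eval R (a ·ₚ g) w      ≈⟨ +-congˡ (eval-·ₚ a g w) ⟩
    (b + w * eval R g w) + a * eval R g w         ≈⟨ +-assoc b _ _ ⟩
    b + (w * eval R g w + a * eval R g w)         ≈⟨ +-congˡ (distribʳ _ w a) ⟨
    b + (w + a) * eval R g w                      ≈⟨ +-congˡ (*-congˡ (eval-shift a f w)) ⟩
    b + (w + a) * eval R f (w + a)                ∎
    where
    open ≈-Reasoning
    g = shift R a f

  shift-constP : ∀ a b → shift R a (constP R b) ≈ₚ constP R b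
  shift-constP a b = coeffwise λ { zero → +-identityʳ b ; (suc k) → refl }

  shift-X : ∀ a → shift R a (X R) ≈ₚ constP R a +ₚ X R
  shift-X a = coeffwise λ
    { zero → begin
        0# + (0# + a * (1# + 0#))   ≈⟨ +-identityˡ _ ⟩
        0# + a * (1# + 0#)          ≈⟨ +-identityˡ _ ⟩
        a * (1# + 0#)               ≈⟨ *-congˡ (+-identityʳ 1#) ⟩
        a * 1#                      ≈⟨ *-identityʳ a ⟩
        a                           ≈⟨ +-identityʳ a ⟨
        a + 0#                      ∎
    ; (suc zero)    → +-identityʳ 1#
    ; (suc (suc k)) → refl
    }
    where open ≈-Reasoning

module LinearOperators {c ℓ} (R : CommutativeRing c ℓ) (d : LinOp R) where

  open CommutativeRing R
  open Polynomials R
  open import Data.Nat as ℕ using (ℕ; zero; suc)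
  open import Relation.Binary.PropositionalEquality as ≡ using (_≡_)

  op-congₚ : ∀ {f g} → f ≈ₚ g → op d f ≈ₚ op d g
  op-congₚ {f} {g} f≈g = coeffwise (op-cong d f g (coeff-≈ f≈g))

  op-+ₚ : ∀ f g → op d (f +ₚ g) ≈ₚ op d f +ₚ op d g
  op-+ₚ f g = coeffwise (op-+ d f g)

  op-·ₚ : ∀ a f → op d (a ·ₚ f) ≈ₚ a ·ₚ op d f
  op-·ₚ a f = coeffwise (op-· d a f)

  -- `0ₚ` is `0# ·ₚ 0ₚ` on the nose.
  op-≈0 : ∀ {f} → f ≈ₚ 0ₚ → op d f ≈ₚ 0ₚ
  op-≈0 f≈0 = ≈ₚ-trans (op-congₚ f≈0) (≈ₚ-trans (op-·ₚ 0# 0ₚ) (·ₚ-zeroˡ (op d 0ₚ) refl))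

  iter-cong : ∀ i {f g} → f ≈ₚ g → iter R d i f ≈ₚ iter R d i g
  iter-cong zero    f≈g = f≈g
  iter-cong (suc i) f≈g = op-congₚ (iter-cong i f≈g)

  iter-≈0 : ∀ i {f} → f ≈ₚ 0ₚ → iter R d i f ≈ₚ 0ₚ
  iter-≈0 zero    f≈0 = f≈0
  iter-≈0 (suc i) f≈0 = op-≈0 (iter-≈0 i f≈0)

  iter-+ₚ : ∀ i f g → iter R d i (f +ₚ g) ≈ₚ iter R d i f +ₚ iter R d i g
  iter-+ₚ zero    f g = ≈ₚ-refl
  iter-+ₚ (suc i) f g = ≈ₚ-trans (op-congₚ (iter-+ₚ i f g)) (op-+ₚ _ _)

  iter-·ₚ : ∀ i a f → iter R d i (a ·ₚ f) ≈ₚ a ·ₚ iter R d i f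
  iter-·ₚ zero    a f = ≈ₚ-refl
  iter-·ₚ (suc i) a f = ≈ₚ-trans (op-congₚ (iter-·ₚ i a f)) (op-·ₚ a _)

  iter-‿ₚ : ∀ i f g → iter R d i (f -ₚ g) ≈ₚ iter R d i f -ₚ iter R d i g
  iter-‿ₚ i f g = ≈ₚ-trans (iter-+ₚ i f _) (+ₚ-cong ≈ₚ-refl (iter-·ₚ i (- 1#) g))

  iter-sumP : ∀ i n g → iter R d i (sumP R n g) ≈ₚ sumP R n (λ k → iter R d i (g k))
  iter-sumP i zero    g = ≈ₚ-refl
  iter-sumP i (suc n) g = ≈ₚ-trans (iter-+ₚ i (sumP R n g) (g (suc n))) (+ₚ-cong (iter-sumP i n g) ≈ₚ-refl)

  iter-+ : ∀ i j f → iter R d (i ℕ.+ j) f ≡ iter R d i (iter R d j f)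
  iter-+ zero    j f = ≡.refl
  iter-+ (suc i) j f = ≡.cong (op d) (iter-+ i j f)

  iter-shift : ShiftInvariant R d → ∀ i a f → iter R d i (shift R a f) ≈ₚ shift R a (iter R d i f)
  iter-shift invariant zero    a f = ≈ₚ-refl
  iter-shift invariant (suc i) a f =
    ≈ₚ-trans (op-congₚ (iter-shift invariant i a f)) (coeffwise (invariant a (iter R d i f)))

module NaturalEmbedding {c ℓ} (R : CommutativeRing c ℓ) where

  open CommutativeRing R
  open import Data.Nat as ℕ using (ℕ; zero; suc; _!)
  open import Data.Nat.Properties using (suc-pred; _!≢0)
  open import Relation.Nullary using (¬_)
  open import Relation.Binary.PropositionalEquality as ≡ using (_≡_)
  open import Algebra.Properties.Semiring.Mult semiring using (_×_; ×1-homo-*)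

  fromℕ≡×1# : ∀ n → fromℕ R n ≡ n × 1#
  fromℕ≡×1# zero    = ≡.refl
  fromℕ≡×1# (suc n) = ≡.cong (1# +_) (fromℕ≡×1# n)

  fromℕ-* : ∀ m n → fromℕ R (m ℕ.* n) ≈ fromℕ R m * fromℕ R n
  fromℕ-* m n rewrite fromℕ≡×1# (m ℕ.* n) | fromℕ≡×1# m | fromℕ≡×1# n = ×1-homo-* m n

  fromℕ-!≉0 : CharZero R → ∀ n → ¬ fromℕ R (n !) ≈ 0#
  fromℕ-!≉0 char0 n = ≡.subst (λ m → ¬ fromℕ R m ≈ 0#) (suc-pred (n !) {{n !≢0}}) (char0 (ℕ.pred (n !)))

module GradedExpansion {c ℓ} (R : CommutativeRing c ℓ) (isField : IsField R)
  (s : ℕ → Poly R) (s-degree : ∀ k → HasDegree R (s k) k) where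

  open CommutativeRing R
  open Polynomials R
  open import Data.Nat using (ℕ; zero; suc; _≤_)
  open import Data.Nat.Properties using (m≤n⇒m<n∨m≡n; 1+n≰n; _≟_)
  open import Data.Bool using (if_then_else_)
  open import Data.Product using (_,_; proj₁; proj₂; ∃)
  open import Data.Sum using (inj₁; inj₂)
  open import Relation.Nullary using (does)
  open import Relation.Nullary.Decidable using (dec-true; dec-false)
  open import Relation.Binary.PropositionalEquality as ≡ using ()

  leading-term : ∀ n f → DegreeBelow f (suc n) → ∃ λ α → DegreeBelow (f -ₚ α ·ₚ s n) n
  leading-term n f deg with proj₂ isField (coeff R (s n) n) (proj₁ (s-degree n))
  ... | b , lead*b≈1 = α , degreeBelow vanish
    where
    open ≈-Reasoning
    α : Carrier
    α = coeff R f n * b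
    α·lead≈ : coeff R (α ·ₚ s n) n ≈ coeff R f n
    α·lead≈ = begin
      coeff R (α ·ₚ s n) n               ≈⟨ coeff-·ₚ α (s n) n ⟩
      (coeff R f n * b) * coeff R (s n) n ≈⟨ *-assoc _ b _ ⟩
      coeff R f n * (b * coeff R (s n) n) ≈⟨ *-congˡ (trans (*-comm b _) lead*b≈1) ⟩
      coeff R f n * 1#                    ≈⟨ *-identityʳ _ ⟩
      coeff R f n                         ∎
    vanish : ∀ k → n ≤ k → coeff R (f -ₚ α ·ₚ s n) k ≈ 0#
    vanish k n≤k with m≤n⇒m<n∨m≡n n≤k
    ... | inj₁ n<k    = coeff-≈0 (degreeBelow-‿ₚ deg (degreeBelow-·ₚ α (hasDegree⇒degreeBelow (s-degree n)))) k n<k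
    ... | inj₂ ≡.refl = trans (coeff-‿ₚ f (α ·ₚ s n) n) (trans (+-congˡ (-‿cong α·lead≈)) (-‿inverseʳ _))

  expansion : ∀ n f → DegreeBelow f (suc n) → ∃ λ (a : ℕ → Carrier) → f ≈ₚ sumP R n (λ k → a k ·ₚ s k)
  expansion zero f deg with leading-term 0 f deg
  ... | α , rest-deg = (λ _ → α) , ≈ₚ-trans (≈ₚ-sym (-ₚ+ₚ-cancel f (α ·ₚ s 0)))
                                            (+ₚ-cong (degreeBelow-zero rest-deg) ≈ₚ-refl)
  expansion (suc n) f deg with leading-term (suc n) f deg
  ... | α , rest-deg with expansion n (f -ₚ α ·ₚ s (suc n)) rest-deg
  ... | a , rest≈ = a′ , (begin
    f                                                     ≈⟨ -ₚ+ₚ-cancel f (α ·ₚ s (suc n)) ⟨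
    (f -ₚ α ·ₚ s (suc n)) +ₚ α ·ₚ s (suc n)               ≈⟨ +ₚ-cong rest≈ ≈ₚ-refl ⟩
    sumP R n (λ k → a k ·ₚ s k) +ₚ α ·ₚ s (suc n)         ≈⟨ +ₚ-cong (sumP-cong n λ k k≤n → ·ₚ-cong (lower k k≤n) ≈ₚ-refl)
                                                                      (·ₚ-cong top ≈ₚ-refl) ⟩
    sumP R (suc n) (λ k → a′ k ·ₚ s k)                    ∎)
    where
    open ≈ₚ-Reasoning
    a′ : ℕ → Carrier
    a′ k = if does (k ≟ suc n) then α else a k
    top : α ≈ a′ (suc n)
    top = reflexive (≡.cong (if_then α else a (suc n)) (≡.sym (dec-true (suc n ≟ suc n) ≡.refl)))
    lower : ∀ k → k ≤ n → a k ≈ a′ k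
    lower k k≤n = reflexive (≡.cong (if_then α else a k) (≡.sym (dec-false (k ≟ suc n) λ { ≡.refl → 1+n≰n k≤n })))

module GoncarovBases {c ℓ} (R : CommutativeRing c ℓ) (isField : IsField R) (char0 : CharZero R)
  (d : LinOp R) where

  open CommutativeRing R
  open Polynomials R
  open LinearOperators R d
  open NaturalEmbedding R
  open import Data.Nat using (ℕ; suc; _≤_; _!)
  open import Data.Product using (_,_; proj₁; proj₂)
  open import Relation.Nullary using (¬_)
  open import Relation.Binary.PropositionalEquality as ≡ using (_≢_)
  open import Algebra.Properties.AbelianGroup +-abelianGroup using (x≈y⇒x∙y⁻¹≈ε)

  eval-iter-combination : ∀ {w s} → IsGoncarovBasis R d w s → ∀ n (a : ℕ → Carrier) {i} → i ≤ n →
    eval R (iter R d i (sumP R n (λ j → a j ·ₚ s j))) (w i) ≈ a i * fromℕ R (i !)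
  eval-iter-combination {w} {s} (_ , diagonal , off-diagonal) n a {i} i≤n = begin
    eval R (iter R d i (sumP R n (λ j → a j ·ₚ s j))) (w i)   ≈⟨ eval-cong (w i) (iter-sumP i n _) ⟩
    eval R (sumP R n (λ j → iter R d i (a j ·ₚ s j))) (w i)   ≈⟨ eval-sumP n _ (w i) ⟩
    sum≤ n (λ j → eval R (iter R d i (a j ·ₚ s j)) (w i))     ≈⟨ sum≤-cong n (λ j _ → term j) ⟩
    sum≤ n (λ j → a j * eval R (iter R d i (s j)) (w i))      ≈⟨ sum≤-single n i≤n other-term ⟩
    a i * eval R (iter R d i (s i)) (w i)                     ≈⟨ *-congˡ (diagonal i) ⟩
    a i * fromℕ R (i !)                                       ∎
    where
    open ≈-Reasoning
    term : ∀ j → eval R (iter R d i (a j ·ₚ s j)) (w i) ≈ a j * eval R (iter R d i (s j)) (w i)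
    term j = trans (eval-cong (w i) (iter-·ₚ i (a j) (s j))) (eval-·ₚ (a j) (iter R d i (s j)) (w i))
    other-term : ∀ j → j ≤ n → j ≢ i → a j * eval R (iter R d i (s j)) (w i) ≈ 0#
    other-term j _ j≢i = trans (*-congˡ (off-diagonal i j λ i≡j → j≢i (≡.sym i≡j))) (zeroʳ _)

  *-cancelʳ-≉0 : ∀ {a u} → ¬ u ≈ 0# → a * u ≈ 0# → a ≈ 0#
  *-cancelʳ-≉0 {a} {u} u≉0 a*u≈0 with proj₂ isField u u≉0
  ... | u⁻¹ , u*u⁻¹≈1 = begin
    a                ≈⟨ *-identityʳ a ⟨
    a * 1#           ≈⟨ *-congˡ u*u⁻¹≈1 ⟨
    a * (u * u⁻¹)    ≈⟨ *-assoc a u u⁻¹ ⟨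
    (a * u) * u⁻¹    ≈⟨ *-congʳ a*u≈0 ⟩
    0# * u⁻¹         ≈⟨ zeroˡ u⁻¹ ⟩
    0#               ∎
    where open ≈-Reasoning

  goncarov-vanishing : ∀ {w s} → IsGoncarovBasis R d w s → ∀ n {f} → DegreeBelow f (suc n) →
    (∀ i → i ≤ n → eval R (iter R d i f) (w i) ≈ 0#) → f ≈ₚ 0ₚ
  goncarov-vanishing {w} {s} basis n {f} deg vanishes
    with GradedExpansion.expansion R isField s (proj₁ basis) n f deg
  ... | a , f≈ = ≈ₚ-trans f≈ (sumP-≈0 n λ i i≤n → ·ₚ-zeroˡ (s i) (coefficient≈0 i i≤n))
    where
    coefficient≈0 : ∀ i → i ≤ n → a i ≈ 0#
    coefficient≈0 i i≤n = *-cancelʳ-≉0 (fromℕ-!≉0 char0 i) (begin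
      a i * fromℕ R (i !)                                        ≈⟨ eval-iter-combination basis n a i≤n ⟨
      eval R (iter R d i (sumP R n (λ j → a j ·ₚ s j))) (w i)    ≈⟨ eval-cong (w i) (iter-cong i f≈) ⟨
      eval R (iter R d i f) (w i)                                ≈⟨ vanishes i i≤n ⟩
      0#                                                         ∎)
      where open ≈-Reasoning

  isGoncarovBasis-resp : ∀ {w w′ s} → (∀ i → w i ≈ w′ i) → IsGoncarovBasis R d w s → IsGoncarovBasis R d w′ s
  isGoncarovBasis-resp {s = s} w≈w′ (degree , diagonal , off-diagonal) =
    degree ,
    (λ n → trans (sym (eval-congʳ (iter R d n (s n)) (w≈w′ n))) (diagonal n)) ,
    (λ i n i≢n → trans (sym (eval-congʳ (iter R d i (s n)) (w≈w′ i))) (off-diagonal i n i≢n))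

  goncarov-unique : ∀ {w s} → IsGoncarovBasis R d w s → ∀ n {f g} →
    DegreeBelow f (suc n) → DegreeBelow g (suc n) →
    (∀ i → i ≤ n → eval R (iter R d i f) (w i) ≈ eval R (iter R d i g) (w i)) → f ≈ₚ g
  goncarov-unique {w} basis n {f} {g} degf degg agree =
    -ₚ≈0⇒≈ₚ (goncarov-vanishing basis n (degreeBelow-‿ₚ degf degg) difference-vanishes)
    where
    difference-vanishes : ∀ i → i ≤ n → eval R (iter R d i (f -ₚ g)) (w i) ≈ 0#
    difference-vanishes i i≤n = trans (eval-cong (w i) (iter-‿ₚ i f g))
      (trans (eval-‿ₚ (iter R d i f) (iter R d i g) (w i)) (x≈y⇒x∙y⁻¹≈ε (agree i i≤n)))

module DeltaOperators {c ℓ} (R : CommutativeRing c ℓ) (isField : IsField R)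
  (d : LinOp R) (delta : IsDelta R d) (p : ℕ → Poly R) (basic : IsBasicSequence R d p) where

  open CommutativeRing R
  open Polynomials R
  open LinearOperators R d
  open NaturalEmbedding R
  open import Data.Nat as ℕ using (ℕ; zero; suc; _≤_; _<_; _∸_; _!; pred; s≤s)
  open import Data.Nat.Properties
    using (+-∸-assoc; n∸n≡0; m∸n+n≡m; m>n⇒m∸n≢0; pred[m∸n]≡m∸[1+n]; <⇒≤; <-cmp; ≤-refl; ≤-trans; n≤1+n)
  open import Data.Nat.Combinatorics.Base using (_P′_)
  open import Data.Nat.Combinatorics.Specification using (nP′n≡n!)
  open import Data.Product using (_,_; proj₁; proj₂)
  open import Relation.Binary.Definitions using (tri<; tri≈; tri>)
  open import Data.Empty using (⊥-elim)
  open import Relation.Binary.PropositionalEquality as ≡ using (_≡_; _≢_)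

  op-constP≈0 : ∀ a → op d (constP R a) ≈ₚ 0ₚ
  op-constP≈0 a = +ₚ-identityˡ-unique (begin
    op d (constP R a) +ₚ op d (X R)   ≈⟨ op-+ₚ (constP R a) (X R) ⟨
    op d (constP R a +ₚ X R)          ≈⟨ op-congₚ (shift-X a) ⟨
    op d (shift R a (X R))            ≈⟨ coeffwise (invariant a (X R)) ⟩
    shift R a (op d (X R))            ≈⟨ shift-cong a op-X≈b ⟩
    shift R a (constP R b)            ≈⟨ shift-constP a b ⟩
    constP R b                        ≈⟨ op-X≈b ⟨
    op d (X R)                        ∎)
    where
    open ≈ₚ-Reasoning
    invariant : ShiftInvariant R d
    invariant = proj₁ delta
    b : Carrier
    b = proj₁ (proj₂ delta)
    op-X≈b : op d (X R) ≈ₚ constP R b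
    op-X≈b = coeffwise (proj₂ (proj₂ (proj₂ delta)))

  op-basic-zero : op d (p 0) ≈ₚ 0ₚ
  op-basic-zero = ≈ₚ-trans (op-congₚ (coeffwise (proj₁ (proj₂ basic)))) (op-constP≈0 1#)

  op-basic-suc : ∀ {m j} → m ≡ suc j → op d (p m) ≈ₚ fromℕ R m ·ₚ p j
  op-basic-suc ≡.refl = coeffwise (proj₂ (proj₂ (proj₂ basic)) _)

  iter-basic : ∀ {i k} → i ≤ k → iter R d i (p k) ≈ₚ fromℕ R (k P′ i) ·ₚ p (k ∸ i)
  iter-basic {zero}  {k} _ = ≈ₚ-sym (≈ₚ-trans (·ₚ-cong (+-identityʳ 1#) ≈ₚ-refl) (·ₚ-identityˡ (p k)))
  iter-basic {suc i} {suc k} (s≤s i≤k) = begin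
    op d (iter R d i (p (suc k)))                          ≈⟨ op-congₚ (iter-basic (≤-trans i≤k (n≤1+n k))) ⟩
    op d (r ·ₚ p (suc k ∸ i))                              ≈⟨ op-·ₚ r (p (suc k ∸ i)) ⟩
    r ·ₚ op d (p (suc k ∸ i))                              ≈⟨ ·ₚ-congˡ r (op-basic-suc (+-∸-assoc 1 i≤k)) ⟩
    r ·ₚ (fromℕ R (suc k ∸ i) ·ₚ p (k ∸ i))                ≈⟨ ·ₚ-assoc r _ (p (k ∸ i)) ⟨
    (r * fromℕ R (suc k ∸ i)) ·ₚ p (k ∸ i)                 ≈⟨ ·ₚ-cong (trans (*-comm r _) (sym (fromℕ-* (suc k ∸ i) _))) ≈ₚ-refl ⟩
    fromℕ R (suc k P′ suc i) ·ₚ p (k ∸ i)                  ∎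
    where
    open ≈ₚ-Reasoning
    r : Carrier
    r = fromℕ R (suc k P′ i)

  iter-basic-beyond : ∀ {k i} → k < i → iter R d i (p k) ≈ₚ 0ₚ
  iter-basic-beyond {k} {i} k<i = begin
    iter R d i (p k)                                  ≡⟨ ≡.cong (λ m → iter R d m (p k)) (≡.sym (m∸n+n≡m k<i)) ⟩
    iter R d ((i ∸ suc k) ℕ.+ suc k) (p k)            ≡⟨ iter-+ (i ∸ suc k) (suc k) (p k) ⟩
    iter R d (i ∸ suc k) (op d (iter R d k (p k)))    ≈⟨ iter-≈0 (i ∸ suc k) top ⟩
    0ₚ                                                ∎
    where
    open ≈ₚ-Reasoning
    r : Carrier
    r = fromℕ R (k P′ k)
    top : op d (iter R d k (p k)) ≈ₚ 0ₚ
    top = begin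
      op d (iter R d k (p k))   ≈⟨ op-congₚ (iter-basic {k} ≤-refl) ⟩
      op d (r ·ₚ p (k ∸ k))     ≈⟨ op-·ₚ r (p (k ∸ k)) ⟩
      r ·ₚ op d (p (k ∸ k))     ≡⟨ ≡.cong (λ m → r ·ₚ op d (p m)) (n∸n≡0 k) ⟩
      r ·ₚ op d (p 0)           ≈⟨ ·ₚ-zeroʳ r op-basic-zero ⟩
      0ₚ                        ∎

  eval-basic-zero : eval R (p 0) 0# ≈ 1#
  eval-basic-zero = trans (eval-cong 0# (coeffwise {p 0} {constP R 1#} (proj₁ (proj₂ basic)))) (eval-constP 1# 0#)

  eval-basic-suc : ∀ {m} → m ≢ 0 → eval R (p m) 0# ≈ 0#
  eval-basic-suc {zero}  m≢0 = ⊥-elim (m≢0 ≡.refl)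
  eval-basic-suc {suc m} _   = proj₁ (proj₂ (proj₂ basic)) m

  basic-isGoncarov : IsGoncarovBasis R d (λ _ → 0#) p
  basic-isGoncarov = proj₁ basic , diagonal , off-diagonal
    where
    open ≈-Reasoning
    eval-iter : ∀ {i k} → i ≤ k → eval R (iter R d i (p k)) 0# ≈ fromℕ R (k P′ i) * eval R (p (k ∸ i)) 0#
    eval-iter {i} {k} i≤k = trans (eval-cong 0# (iter-basic i≤k)) (eval-·ₚ _ (p (k ∸ i)) 0#)
    diagonal : ∀ k → eval R (iter R d k (p k)) 0# ≈ fromℕ R (k !)
    diagonal k = begin
      eval R (iter R d k (p k)) 0#                   ≈⟨ eval-iter {k} ≤-refl ⟩
      fromℕ R (k P′ k) * eval R (p (k ∸ k)) 0#       ≡⟨ ≡.cong₂ (λ m j → fromℕ R m * eval R (p j) 0#) (nP′n≡n! k) (n∸n≡0 k) ⟩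
      fromℕ R (k !) * eval R (p 0) 0#                ≈⟨ *-congˡ eval-basic-zero ⟩
      fromℕ R (k !) * 1#                             ≈⟨ *-identityʳ _ ⟩
      fromℕ R (k !)                                  ∎
    off-diagonal : ∀ i k → i ≢ k → eval R (iter R d i (p k)) 0# ≈ 0#
    off-diagonal i k i≢k with <-cmp i k
    ... | tri< i<k _ _ = trans (eval-iter (<⇒≤ i<k)) (trans (*-congˡ (eval-basic-suc (m>n⇒m∸n≢0 i<k))) (zeroʳ _))
    ... | tri≈ _ i≡k _ = ⊥-elim (i≢k i≡k)
    ... | tri> _ _ k<i = eval-≈0 0# (iter-basic-beyond k<i)

  op-degreeBelow : ∀ {f m} → DegreeBelow f m → DegreeBelow (op d f) (pred m)
  op-degreeBelow {m = zero} deg = degreeBelow-≈0 (op-≈0 (degreeBelow-zero deg))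
  op-degreeBelow {f} {suc m} deg with GradedExpansion.expansion R isField p (proj₁ basic) m f deg
  ... | a , f≈ = degreeBelow-cong (≈ₚ-sym op-f≈) (degreeBelow-sumP m λ k k≤m → degreeBelow-·ₚ (a k) (term k k≤m))
    where
    op-f≈ : op d f ≈ₚ sumP R m (λ k → a k ·ₚ op d (p k))
    op-f≈ = ≈ₚ-trans (iter-cong 1 f≈) (≈ₚ-trans (iter-sumP 1 m _) (sumP-cong m λ k _ → op-·ₚ (a k) (p k)))
    term : ∀ k → k ≤ m → DegreeBelow (op d (p k)) m
    term zero    _   = degreeBelow-≈0 op-basic-zero
    term (suc j) j<m = degreeBelow-cong (≈ₚ-sym (op-basic-suc ≡.refl))
      (degreeBelow-·ₚ _ (degreeBelow-mono j<m (hasDegree⇒degreeBelow (proj₁ basic j))))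

  iter-degreeBelow : ∀ i {f m} → DegreeBelow f m → DegreeBelow (iter R d i f) (m ∸ i)
  iter-degreeBelow zero    deg = deg
  iter-degreeBelow (suc i) {m = m} deg =
    ≡.subst (DegreeBelow _) (pred[m∸n]≡m∸[1+n] m i) (op-degreeBelow (iter-degreeBelow i deg))

module GoncarovExpansion {c ℓ} (R : CommutativeRing c ℓ) (isField : IsField R) (char0 : CharZero R)
  (d : LinOp R) (delta : IsDelta R d) (p : ℕ → Poly R) (basic : IsBasicSequence R d p) where

  open CommutativeRing R
  open Polynomials R
  open LinearOperators R d
  open NaturalEmbedding R
  open GoncarovBases R isField char0 d
  open DeltaOperators R isField d delta p basic
  open Binomial using (nCk*k!*[n∸k]!≡n!)
  open import Data.Nat as ℕ using (ℕ; suc; _≤_; _∸_; _!; s≤s)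
  open import Data.Nat.Properties using (+-∸-assoc; m∸n+n≡m; m+n∸n≡m; _≟_)
  open import Data.Nat.Combinatorics using (_C_)
  open import Data.Product using (_,_; proj₁)
  open import Relation.Nullary using (yes; no)
  open import Relation.Binary.PropositionalEquality as ≡ using (_≡_; _≢_)
  open import Algebra.Properties.CommutativeSemigroup *-commutativeSemigroup using (xy∙z≈xz∙y)

  -- Both sides agree on the functionals ε_{w(i+k)} ∘ 𝔡ⁱ defining the basis u, where they give n! δ_{i+k,n}.
  iter-goncarov : ∀ {w : ℕ → Carrier} {s u : ℕ → Poly R} k →
    IsGoncarovBasis R d w s → IsGoncarovBasis R d (λ i → w (i ℕ.+ k)) u →
    ∀ {n} → k ≤ n → iter R d k (s n) ≈ₚ fromℕ R ((n C k) ℕ.* k !) ·ₚ u (n ∸ k)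
  iter-goncarov {w} {s} {u} k (s-degree , s-diagonal , s-off) u-basis@(u-degree , u-diagonal , u-off) {n} k≤n =
    goncarov-unique u-basis (n ∸ k) lhs-degree (degreeBelow-·ₚ r (hasDegree⇒degreeBelow {u (n ∸ k)} (u-degree (n ∸ k))))
      agree
    where
    open ≈-Reasoning
    r : Carrier
    r = fromℕ R ((n C k) ℕ.* k !)
    φ : ℕ → Poly R → Carrier
    φ i f = eval R (iter R d i f) (w (i ℕ.+ k))
    lhs-degree : DegreeBelow (iter R d k (s n)) (suc (n ∸ k))
    lhs-degree = ≡.subst (DegreeBelow _) (+-∸-assoc 1 k≤n)
      (iter-degreeBelow k (hasDegree⇒degreeBelow {s n} (s-degree n)))
    lhs : ∀ i → φ i (iter R d k (s n)) ≡ eval R (iter R d (i ℕ.+ k) (s n)) (w (i ℕ.+ k))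
    lhs i = ≡.cong (λ f → eval R f (w (i ℕ.+ k))) (≡.sym (iter-+ i k (s n)))
    rhs : ∀ i → φ i (r ·ₚ u (n ∸ k)) ≈ r * φ i (u (n ∸ k))
    rhs i = trans (eval-cong _ (iter-·ₚ i r (u (n ∸ k)))) (eval-·ₚ r (iter R d i (u (n ∸ k))) (w (i ℕ.+ k)))
    agree : ∀ i → i ≤ n ∸ k → φ i (iter R d k (s n)) ≈ φ i (r ·ₚ u (n ∸ k))
    agree i _ with i ≟ n ∸ k
    ... | yes ≡.refl = begin
      φ i (iter R d k (s n))                            ≡⟨ lhs i ⟩
      eval R (iter R d (i ℕ.+ k) (s n)) (w (i ℕ.+ k))   ≡⟨ ≡.cong (λ m → eval R (iter R d m (s n)) (w m)) (m∸n+n≡m k≤n) ⟩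
      eval R (iter R d n (s n)) (w n)                   ≈⟨ s-diagonal n ⟩
      fromℕ R (n !)                                     ≡⟨ ≡.cong (fromℕ R) (≡.sym (nCk*k!*[n∸k]!≡n! k≤n)) ⟩
      fromℕ R ((n C k) ℕ.* k ! ℕ.* i !)                 ≈⟨ fromℕ-* ((n C k) ℕ.* k !) (i !) ⟩
      r * fromℕ R (i !)                                 ≈⟨ *-congˡ (u-diagonal i) ⟨
      r * φ i (u i)                                     ≈⟨ rhs i ⟨
      φ i (r ·ₚ u i)                                    ∎
    ... | no i≢n∸k = begin
      φ i (iter R d k (s n))                            ≡⟨ lhs i ⟩
      eval R (iter R d (i ℕ.+ k) (s n)) (w (i ℕ.+ k))   ≈⟨ s-off (i ℕ.+ k) n i+k≢n ⟩
      0#                                                ≈⟨ zeroʳ r ⟨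
      r * 0#                                            ≈⟨ *-congˡ (u-off i (n ∸ k) i≢n∸k) ⟨
      r * φ i (u (n ∸ k))                               ≈⟨ rhs i ⟨
      φ i (r ·ₚ u (n ∸ k))                              ∎
      where
      i+k≢n : i ℕ.+ k ≢ n
      i+k≢n i+k≡n = i≢n∸k (≡.trans (≡.sym (m+n∸n≡m i k)) (≡.cong (_∸ k) i+k≡n))

  -- Both sides agree on the functionals ε₀ ∘ 𝔡ⁱ, for which (pᵢ) is the Gončarov basis.
  shift-goncarov : ∀ {w : ℕ → Carrier} {s : ℕ → Poly R} {u : ℕ → ℕ → Poly R} →
    IsGoncarovBasis R d w s → (∀ k → IsGoncarovBasis R d (λ i → w (i ℕ.+ k)) (u k)) →
    ∀ ξ n → shift R ξ (s n) ≈ₚ sumP R n (λ i → (fromℕ R (n C i) * eval R (u i (n ∸ i)) ξ) ·ₚ p i)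
  shift-goncarov {w} {s} {u} s-basis u-basis ξ n =
    goncarov-unique basic-isGoncarov n (shift-degreeBelow ξ (hasDegree⇒degreeBelow {s n} (proj₁ s-basis n)))
      (degreeBelow-sumP n λ i i≤n →
        degreeBelow-·ₚ (a i) (degreeBelow-mono (s≤s i≤n) (hasDegree⇒degreeBelow {p i} (proj₁ basic i))))
      agree
    where
    open ≈-Reasoning
    a : ℕ → Carrier
    a i = fromℕ R (n C i) * eval R (u i (n ∸ i)) ξ
    φ : ℕ → Poly R → Carrier
    φ i f = eval R (iter R d i f) 0#
    agree : ∀ i → i ≤ n → φ i (shift R ξ (s n)) ≈ φ i (sumP R n (λ j → a j ·ₚ p j))
    agree i i≤n = begin
      φ i (shift R ξ (s n))                                      ≈⟨ eval-cong 0# (iter-shift (proj₁ delta) i ξ (s n)) ⟩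
      eval R (shift R ξ (iter R d i (s n))) 0#                   ≈⟨ eval-shift ξ (iter R d i (s n)) 0# ⟩
      eval R (iter R d i (s n)) (0# + ξ)                         ≈⟨ eval-congʳ (iter R d i (s n)) (+-identityˡ ξ) ⟩
      eval R (iter R d i (s n)) ξ                                ≈⟨ eval-cong ξ (iter-goncarov i s-basis (u-basis i) i≤n) ⟩
      eval R (fromℕ R ((n C i) ℕ.* i !) ·ₚ u i (n ∸ i)) ξ        ≈⟨ eval-·ₚ _ (u i (n ∸ i)) ξ ⟩
      fromℕ R ((n C i) ℕ.* i !) * eval R (u i (n ∸ i)) ξ         ≈⟨ *-congʳ (fromℕ-* (n C i) (i !)) ⟩
      fromℕ R (n C i) * fromℕ R (i !) * eval R (u i (n ∸ i)) ξ   ≈⟨ xy∙z≈xz∙y _ _ _ ⟩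
      a i * fromℕ R (i !)                                        ≈⟨ eval-iter-combination basic-isGoncarov n a i≤n ⟨
      φ i (sumP R n (λ j → a j ·ₚ p j))                          ∎

open import Data.Nat using (ℕ; _+_; _∸_)
open import Data.Nat.Combinatorics using (_C_)
open import Data.Product using (_×_; _,_)
open import Data.Nat.Properties using (+-identityʳ)
open import Relation.Binary.PropositionalEquality using (cong)

proposition3p8 : ∀ {c ℓ} (R : CommutativeRing c ℓ) → IsField R → CharZero R →
    (d : LinOp R) → IsDelta R d →
    (p : ℕ → Poly R) → IsBasicSequence R d p →
    (z : ℕ → CommutativeRing.Carrier R) →
    (t : ℕ → ℕ → Poly R) → (∀ j → IsGoncarovBasis R d (λ i → z (i + j)) (t j)) →
    ((ξ : CommutativeRing.Carrier R) (n : ℕ) →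
      _≈P_ R (shift R ξ (t 0 n))
        (sumP R n (λ i → _·P_ R (CommutativeRing._*_ R (fromℕ R (n C i)) (eval R (t i (n ∸ i)) ξ)) (p i))))
    × ((n : ℕ) →
      _≈P_ R (t 0 n)
        (sumP R n (λ i → _·P_ R (CommutativeRing._*_ R (fromℕ R (n C i)) (eval R (t i (n ∸ i)) (CommutativeRing.0# R))) (p i))))
proposition3p8 R isField char0 d delta p basic z t t-basis =
  (λ ξ n → coeff-≈ (expansion ξ n)) ,
  (λ n → coeff-≈ (≈ₚ-trans (≈ₚ-sym (shift-0# (t 0 n))) (expansion 0# n)))
  where
  open CommutativeRing R using (_*_; 0#; reflexive)
  open Polynomials R
  open GoncarovBases R isField char0 d using (isGoncarovBasis-resp)
  open GoncarovExpansion R isField char0 d delta p basic using (shift-goncarov)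
  t₀-basis : IsGoncarovBasis R d z (t 0)
  t₀-basis = isGoncarovBasis-resp (λ i → reflexive (cong z (+-identityʳ i))) (t-basis 0)
  expansion : ∀ ξ n → shift R ξ (t 0 n) ≈ₚ sumP R n (λ i → (fromℕ R (n C i) * eval R (t i (n ∸ i)) ξ) ·ₚ p i)
  expansion = shift-goncarov t₀-basis t-basis
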